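{- Let $P$ be a (loopless) polymatroid on $E$ with minimal multisymmetric lift $\widetilde P$ and projection $\pi:\widetilde E\to E$, and let $\mathscr G$ be a geometric building set for $P$ containing $E$. Then $\mathscr N\subseteq\mathscr G$ is $\mathscr G$-nested if and only if $\widetilde{\mathscr N}=\{\pi^{ -1}(F):F\in\mathscr N\}$ is $\widetilde{\mathscr G}$-nested, where $\widetilde{\mathscr G}=\{\pi^{ -1}(G):G\in\mathscr G\}\cup\{\text{atoms of }\mathcal L_{\widetilde P}\}$.
   Context: A polymatroid on a finite set $E$ is a function $\mathrm{rk}:2^E\to\mathbb Z_{\ge0}$ that is submodular, monotone, $\mathrm{rk}(\emptyset)=0$, and loopless. Flats are subsets maximal among sets of their rank, forming a lattice $\mathcal L_P$; $\mathrm{cl}_P(A)$ is the smallest flat containing $A$. For $E=\{1,\dots,n\}$, $\widetilde P$ is the matroid on $\widetilde E=\bigsqcup_i\widetilde E_i$, $\widetilde E_i=\{1,\dots,\mathrm{rk}_P(i)\}$ (disjoint), $\pi^{ -1}(i)=\widetilde E_i$, $\mathrm{rk}_{\widetilde P}(S)=\min_{A\subseteq E}(\mathrm{rk}_P(A)+|S\setminus\pi^{ -1}(A)|)$. A geometric building set of a polymatroid $Q$ is a collection $\mathscr G$ of nonempty flats such that for each nonempty flat $F$, with $\max\mathscr G_{\le F}$ the maximal elements of $\mathscr G$ contained in $F$, the join map $\prod_{G\in\max\mathscr G_{\le F}}\mathcal L_{Q|_G}\to\mathcal L_{Q|_F}$ is an isomorphism and $\sum_{G\in\max\mathscr G_{\le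 F}}\mathrm{rk}(G)=\mathrm{rk}(F)$. Given a building set $\mathscr G$ of $Q$, a subset $\mathscr N\subseteq\mathscr G$ is $\mathscr G$-nested if for every set $\{F_1,\dots,F_k\}\subseteq\mathscr N$ of pairwise incomparable flats with $k\ge2$, $\mathrm{cl}_Q(F_1\cup\cdots\cup F_k)\notin\mathscr G$ (nestedness for $\widetilde{\mathscr G}$ is taken in $\widetilde P$). -}

module Defs where

open import Data.Nat using (ℕ; zero; suc; _+_; _≤_; _<_; _⊓_)
open import Data.Fin using (Fin; splitAt)
import Data.Fin as F
open import Data.Fin.Subset
open import Data.Bool using (Bool; true; false)
open import Data.Vec using (Vec; []; _∷_; tabulate; lookup)
open import Data.List using (List; []; _∷_; map; _++_; foldr; length)
open import Data.Nat.ListAction using (sum)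
open import Data.List.Membership.Propositional using () renaming (_∈_ to _∈ₗ_)
open import Data.List.Relation.Unary.All using (All)
open import Data.List.Relation.Unary.AllPairs using (AllPairs)
open import Data.List.Relation.Unary.Unique.Propositional using (Unique)
open import Data.List.Relation.Binary.Pointwise using (Pointwise)
open import Data.Product using (Σ; ∃; _×_; _,_)
open import Data.Sum using (_⊎_; inj₁; inj₂)
open import Relation.Nullary using (¬_)
open import Relation.Binary.PropositionalEquality using (_≡_)
open import Level using (0ℓ)
open import Relation.Unary using (Pred)

record IsPolymatroid {n : ℕ} (rk : Subset n → ℕ) : Set where
  field
    rk-empty    : rk ⊥ ≡ 0
    monotone    : ∀ A B → A ⊆ B → rk A ≤ rk B
    submodular  : ∀ A B → rk (A ∪ B) + rk (A ∩ B) ≤ rk A + rk B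
    loopless    : ∀ i → 0 < rk ⁅ i ⁆

IsFlat : ∀ {n} → (Subset n → ℕ) → Subset n → Set
IsFlat rk F = ∀ B → F ⊆ B → rk B ≡ rk F → B ⊆ F

IsClosure : ∀ {n} → (Subset n → ℕ) → Subset n → Subset n → Set
IsClosure rk A C = IsFlat rk C × A ⊆ C × (∀ G → IsFlat rk G → A ⊆ G → C ⊆ G)

IsAtom : ∀ {n} → (Subset n → ℕ) → Subset n → Set
IsAtom rk F = IsFlat rk F
            × ¬ IsClosure rk ⊥ F
            × (∀ G → IsFlat rk G → G ⊆ F → G ≡ F ⊎ IsClosure rk ⊥ G)

MaxBelow : ∀ {n} → Pred (Subset n) 0ℓ → Subset n → Subset n → Set
MaxBelow 𝒢 F G = 𝒢 G × G ⊆ F × (∀ G' → 𝒢 G' → G ⊆ G' → G' ⊆ F → G' ≡ G)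

Enumerates : ∀ {n} → Pred (Subset n) 0ℓ → List (Subset n) → Set
Enumerates P Ms = Unique Ms × (∀ G → (G ∈ₗ Ms → P G) × (P G → G ∈ₗ Ms))

-- An element of ∏_{G ∈ Ms} L_{Q|G}: one flat X_G ⊆ G for each G in Ms
-- (for a flat G, the flats of Q|G are exactly the flats of Q contained in G).
IsTuple : ∀ {n} → (Subset n → ℕ) → List (Subset n) → List (Subset n) → Set
IsTuple rk Ms Xs = Pointwise (λ X G → IsFlat rk X × X ⊆ G) Xs Ms

-- The join map (X_G)_G ↦ cl(⋃ X_G) from ∏_{G ∈ Ms} L_{Q|G} to L_{Q|F}
-- is an isomorphism of lattices (bijective, order preserving and reflecting).
JoinIso : ∀ {n} → (Subset n → ℕ) → Subset n → List (Subset n) → Set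
JoinIso rk F Ms =
    (∀ H → IsFlat rk H → H ⊆ F → ∃ λ Xs → IsTuple rk Ms Xs × IsClosure rk (⋃ Xs) H)
  × (∀ Xs Ys H K → IsTuple rk Ms Xs → IsTuple rk Ms Ys →
       IsClosure rk (⋃ Xs) H → IsClosure rk (⋃ Ys) K →
       (Pointwise _⊆_ Xs Ys → H ⊆ K) × (H ⊆ K → Pointwise _⊆_ Xs Ys))

record IsGeometricBuildingSet {n : ℕ} (rk : Subset n → ℕ) (𝒢 : Pred (Subset n) 0ℓ) : Set where
  field
    nonempty-flats : ∀ G → 𝒢 G → IsFlat rk G × Nonempty G
    decomposition  : ∀ F → IsFlat rk F → Nonempty F →
      ∃ λ Ms → Enumerates (MaxBelow 𝒢 F) Ms × JoinIso rk F Ms × sum (map rk Ms) ≡ rk F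

Incomparable : ∀ {n} → Subset n → Subset n → Set
Incomparable A B = ¬ (A ⊆ B) × ¬ (B ⊆ A)

IsNested : ∀ {n} → (Subset n → ℕ) → Pred (Subset n) 0ℓ → Pred (Subset n) 0ℓ → Set
IsNested rk 𝒢 𝒩 = ∀ (Fs : List (Subset n)) → All 𝒩 Fs → AllPairs Incomparable Fs →
  2 ≤ length Fs → ∀ C → IsClosure rk (⋃ Fs) C → ¬ 𝒢 C
  where n = _

-- The minimal multisymmetric lift.
-- Ẽ = ⊔ᵢ Ẽᵢ with |Ẽᵢ| = r i is encoded as Fin (total r), blocks in order.

total : ∀ {n} → (Fin n → ℕ) → ℕ
total {zero}  r = 0
total {suc n} r = r F.zero + total (λ i → r (F.suc i))

proj : ∀ {n} (r : Fin n → ℕ) → Fin (total r) → Fin n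
proj {suc n} r x with splitAt (r F.zero) x
... | inj₁ _ = F.zero
... | inj₂ y = F.suc (proj (λ i → r (F.suc i)) y)

allSubsets : ∀ n → List (Subset n)
allSubsets zero    = [] ∷ []
allSubsets (suc n) = map (false ∷_) (allSubsets n) ++ map (true ∷_) (allSubsets n)

module Lift {n : ℕ} (rk : Subset n → ℕ) where

  r : Fin n → ℕ
  r i = rk ⁅ i ⁆

  m : ℕ
  m = total r

  π : Fin m → Fin n
  π = proj r

  preimage : Subset n → Subset m
  preimage A = tabulate (λ x → lookup A (π x))

  rk~ : Subset m → ℕ
  rk~ S = foldr _⊓_ (rk ⊥ + ∣ S ∣) (map (λ A → rk A + ∣ S ─ preimage A ∣) (allSubsets n))

  G~ : Pred (Subset n) 0ℓ → Pred (Subset m) 0ℓ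
  G~ 𝒢 S = (∃ λ G → 𝒢 G × S ≡ preimage G) ⊎ IsAtom rk~ S

  N~ : Pred (Subset n) 0ℓ → Pred (Subset m) 0ℓ
  N~ 𝒩 S = ∃ λ F → 𝒩 F × S ≡ preimage F

module Submission where

-- The preimage map X ↦ π⁻¹(X) embeds the lattice of flats of P into that of P̃
-- and commutes with closures.  Indeed rk_P̃(π⁻¹ X) = rk X, so π⁻¹ of a flat is a
-- flat; and for a flat H of P̃ the set of i whose whole fibre lies in H is a
-- flat of P, which makes it a right adjoint of π⁻¹ on flats.  Hence
-- cl_P̃(⋃ π⁻¹ Fⱼ) = π⁻¹ cl_P(⋃ Fⱼ), and since π is onto (P is loopless),
-- π⁻¹ preserves and reflects incomparability.  The two nestedness conditions
-- therefore correspond, except for the atoms added to 𝒢̃; but an atom cannot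
-- contain two incomparable flats.

open import Defs
open import Data.Bool using (Bool; true; false)
open import Data.Fin using (Fin; _↑ˡ_; _↑ʳ_)
import Data.Fin as Fin
open import Data.Fin.Properties using (splitAt-↑ˡ; splitAt-↑ʳ)
open import Data.Fin.Subset
open import Data.Fin.Subset.Properties
open import Data.List using (List; []; _∷_; map; length)
open import Data.List.Properties using (length-map; foldr-preservesᵇ; foldr-preservesᵒ)
open import Data.List.Membership.Propositional using () renaming (_∈_ to _∈ₗ_)
open import Data.List.Membership.Propositional.Properties
  using (∈-map⁺; ∈-map⁻; ∈-++⁺ˡ; ∈-++⁺ʳ; foldr-selective)
open import Data.List.Relation.Unary.All as All using (All; []; _∷_)
import Data.List.Relation.Unary.All.Properties as All
open import Data.List.Relation.Unary.AllPairs as AllPairs using (AllPairs; []; _∷_)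
import Data.List.Relation.Unary.AllPairs.Properties as AllPairs
import Data.List.Relation.Unary.Any as Any
open import Data.Nat using (ℕ; zero; suc; _+_; _≤_; _<_; z≤n; s≤s)
open import Data.Nat.Properties
open import Data.Product using (∃; _×_; _,_; proj₁)
open import Data.Sum using (inj₁; inj₂; [_,_])
import Data.Sum as Sum
open import Data.Vec using ([]; _∷_; here; there; tabulate; lookup)
open import Data.Vec.Properties
  using (lookup∘tabulate; tabulate-cong; []=⇒lookup; lookup⇒[]=)
open import Function using (_∘_)
open import Level using (0ℓ)
open import Relation.Binary.PropositionalEquality hiding ([_])
open import Relation.Nullary using (¬_; yes; no; does; contradiction)
open import Relation.Nullary.Decidable using (dec-true)
open import Relation.Unary using (Pred)

x∈p─q⇒x∉q : ∀ {k} {x : Fin k} (p q : Subset k) → x ∈ p ─ q → x ∉ q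
x∈p─q⇒x∉q (_ ∷ p) (true ∷ q) () here
x∈p─q⇒x∉q (_ ∷ p) (_ ∷ q) (there x∈p─q) (there x∈q) = x∈p─q⇒x∉q p q x∈p─q x∈q

p⊆q⇒p─r⊆q─r : ∀ {k} {p q : Subset k} (r : Subset k) → p ⊆ q → p ─ r ⊆ q ─ r
p⊆q⇒p─r⊆q─r {p = p} r p⊆q x∈ = x∈p∧x∉q⇒x∈p─q (p⊆q (p─q⊆p p r x∈)) (x∈p─q⇒x∉q p r x∈)

p⊆[p─q]∪q : ∀ {k} (p q : Subset k) → p ⊆ (p ─ q) ∪ q
p⊆[p─q]∪q p q {x} x∈p with x ∈? q
... | yes x∈q = x∈p∪q⁺ (inj₂ x∈q)
... | no  x∉q = x∈p∪q⁺ (inj₁ (x∈p∧x∉q⇒x∈p─q x∈p x∉q))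

∪-lub : ∀ {k} {p q r : Subset k} → p ⊆ r → q ⊆ r → p ∪ q ⊆ r
∪-lub {p = p} {q} p⊆r q⊆r x∈ = [ p⊆r , q⊆r ] (x∈p∪q⁻ p q x∈)

x∈p⇒⁅x⁆⊆p : ∀ {k} {x : Fin k} {p} → x ∈ p → ⁅ x ⁆ ⊆ p
x∈p⇒⁅x⁆⊆p {x = x} {p} x∈p y∈ = subst (_∈ p) (sym (x∈⁅y⁆⇒x≡y x y∈)) x∈p

∣p∣≡∣p∩q∣+∣p─q∣ : ∀ {k} (p q : Subset k) → ∣ p ∣ ≡ ∣ p ∩ q ∣ + ∣ p ─ q ∣
∣p∣≡∣p∩q∣+∣p─q∣ []         []          = refl
∣p∣≡∣p∩q∣+∣p─q∣ (true ∷ p) (true  ∷ q) = cong suc (∣p∣≡∣p∩q∣+∣p─q∣ p q)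
∣p∣≡∣p∩q∣+∣p─q∣ (true ∷ p) (false ∷ q) = trans (cong suc (∣p∣≡∣p∩q∣+∣p─q∣ p q)) (sym (+-suc _ _))
∣p∣≡∣p∩q∣+∣p─q∣ (false ∷ p) (true  ∷ q) = ∣p∣≡∣p∩q∣+∣p─q∣ p q
∣p∣≡∣p∩q∣+∣p─q∣ (false ∷ p) (false ∷ q) = ∣p∣≡∣p∩q∣+∣p─q∣ p q

∣p─p∣≡0 : ∀ {k} (p : Subset k) → ∣ p ─ p ∣ ≡ 0
∣p─p∣≡0 []          = refl
∣p─p∣≡0 (true  ∷ p) = ∣p─p∣≡0 p
∣p─p∣≡0 (false ∷ p) = ∣p─p∣≡0 p

0<∣p∣⇒Nonempty : ∀ {k} {p : Subset k} → 0 < ∣ p ∣ → Nonempty p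
0<∣p∣⇒Nonempty {k} {p} 0<∣p∣ with nonempty? p
... | yes p≢∅ = p≢∅
... | no  p≡∅ = contradiction (trans (cong ∣_∣ (Empty-unique p≡∅)) (∣⊥∣≡0 k)) (n>0⇒n≢0 0<∣p∣)

∈-allSubsets : ∀ {k} (p : Subset k) → p ∈ₗ allSubsets k
∈-allSubsets []          = Any.here refl
∈-allSubsets (false ∷ p) = ∈-++⁺ˡ (∈-map⁺ (false ∷_) (∈-allSubsets p))
∈-allSubsets (true  ∷ p) = ∈-++⁺ʳ (map (false ∷_) (allSubsets _)) (∈-map⁺ (true ∷_) (∈-allSubsets p))

∈-tabulate⁺ : ∀ {k} {f : Fin k → Bool} {x} → f x ≡ true → x ∈ tabulate f
∈-tabulate⁺ {f = f} {x} fx≡true = lookup⇒[]= x (tabulate f) (trans (lookup∘tabulate f x) fx≡true)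

∈-tabulate⁻ : ∀ {k} {f : Fin k → Bool} {x} → x ∈ tabulate f → f x ≡ true
∈-tabulate⁻ {f = f} {x} x∈ = trans (sym (lookup∘tabulate f x)) ([]=⇒lookup x∈)

∣tabulate∣-↑ : ∀ a {b} (f : Fin (a + b) → Bool) →
  ∣ tabulate f ∣ ≡ ∣ tabulate (λ j → f (j ↑ˡ b)) ∣ + ∣ tabulate (λ j → f (a ↑ʳ j)) ∣
∣tabulate∣-↑ zero    f = refl
∣tabulate∣-↑ (suc a) f with f Fin.zero
... | true  = cong suc (∣tabulate∣-↑ a (f ∘ Fin.suc))
... | false = ∣tabulate∣-↑ a (f ∘ Fin.suc)

fibre : ∀ {n} (r : Fin n → ℕ) → Fin n → Subset (total r)
fibre r i = tabulate (λ x → lookup ⁅ i ⁆ (proj r x))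

proj-↑ˡ : ∀ {n} (r : Fin (suc n) → ℕ) (j : Fin (r Fin.zero)) →
  proj r (j ↑ˡ total (r ∘ Fin.suc)) ≡ Fin.zero
proj-↑ˡ r j rewrite splitAt-↑ˡ (r Fin.zero) j (total (r ∘ Fin.suc)) = refl

proj-↑ʳ : ∀ {n} (r : Fin (suc n) → ℕ) (y : Fin (total (r ∘ Fin.suc))) →
  proj r (r Fin.zero ↑ʳ y) ≡ Fin.suc (proj (r ∘ Fin.suc) y)
proj-↑ʳ r y rewrite splitAt-↑ʳ (r Fin.zero) (total (r ∘ Fin.suc)) y = refl

r≤∣fibre∣ : ∀ {n} (r : Fin n → ℕ) (i : Fin n) → r i ≤ ∣ fibre r i ∣
r≤∣fibre∣ {suc n} r i = begin
  r i                                 ≤⟨ blocks i ⟩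
  ∣ first i ∣ + ∣ rest i ∣            ≡⟨ sym (∣tabulate∣-↑ (r Fin.zero) (λ x → lookup ⁅ i ⁆ (proj r x))) ⟩
  ∣ fibre r i ∣                       ∎
  where
  open ≤-Reasoning
  first rest : Fin (suc n) → Subset _
  first i = tabulate (λ j → lookup ⁅ i ⁆ (proj r (j ↑ˡ total (r ∘ Fin.suc))))
  rest  i = tabulate (λ y → lookup ⁅ i ⁆ (proj r (r Fin.zero ↑ʳ y)))
  blocks : ∀ i → r i ≤ ∣ first i ∣ + ∣ rest i ∣
  blocks Fin.zero = begin
    r Fin.zero                  ≡⟨ sym (∣⊤∣≡n (r Fin.zero)) ⟩
    ∣ ⊤ {r Fin.zero} ∣          ≤⟨ p⊆q⇒∣p∣≤∣q∣ {p = ⊤} {first Fin.zero} (λ _ → ∈-tabulate⁺ (cong (lookup ⁅ Fin.zero ⁆) (proj-↑ˡ r _))) ⟩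
    ∣ first Fin.zero ∣          ≤⟨ m≤m+n _ _ ⟩
    ∣ first Fin.zero ∣ + ∣ rest Fin.zero ∣ ∎
  blocks (Fin.suc i) = begin
    r (Fin.suc i)               ≤⟨ r≤∣fibre∣ (r ∘ Fin.suc) i ⟩
    ∣ fibre (r ∘ Fin.suc) i ∣   ≡⟨ cong ∣_∣ (tabulate-cong (λ y → cong (lookup ⁅ Fin.suc i ⁆) (sym (proj-↑ʳ r y)))) ⟩
    ∣ rest (Fin.suc i) ∣        ≤⟨ m≤n+m _ _ ⟩
    ∣ first (Fin.suc i) ∣ + ∣ rest (Fin.suc i) ∣ ∎

all-image : ∀ {A B : Set} {P : A → Set} (f : A → B) {ys : List B} →
  All (λ y → ∃ λ x → P x × y ≡ f x) ys → ∃ λ xs → ys ≡ map f xs × All P xs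
all-image f [] = [] , refl , []
all-image f ((x , px , refl) ∷ pys) with all-image f pys
... | xs , refl , pxs = x ∷ xs , refl , px ∷ pxs

atom-⊉-incomparable : ∀ {k} {rk : Subset k → ℕ} {C} (Xs : List (Subset k)) →
  All (IsFlat rk) Xs → AllPairs Incomparable Xs → 2 ≤ length Xs → ⋃ Xs ⊆ C → ¬ IsAtom rk C
atom-⊉-incomparable (_ ∷ []) _ _ (s≤s ())
atom-⊉-incomparable (X₁ ∷ X₂ ∷ _) (flat₁ ∷ flat₂ ∷ _) (((X₁⊈X₂ , X₂⊈X₁) ∷ _) ∷ _) _ ⋃⊆C (_ , _ , below)
  with below X₁ flat₁ (⋃⊆C ∘ p⊆p∪q _)
... | inj₁ refl             = X₂⊈X₁ (⋃⊆C ∘ q⊆p∪q X₁ _ ∘ p⊆p∪q _)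
... | inj₂ (_ , _ , least) = X₁⊈X₂ (least X₂ flat₂ ⊥⊆)

module Polymatroid {n : ℕ} {rk : Subset n → ℕ} (isP : IsPolymatroid rk) where
  open IsPolymatroid isP
  open Lift rk

  rk-∪-≤ : ∀ A B → rk (A ∪ B) ≤ rk A + rk B
  rk-∪-≤ A B = ≤-trans (m≤m+n _ _) (submodular A B)

  rk-∪-absorb : ∀ A {B D} → D ⊆ B → rk B ≡ rk D → rk (A ∪ B) ≤ rk (A ∪ D)
  rk-∪-absorb A {B} {D} D⊆B rkB≡rkD = +-cancelʳ-≤ (rk D) (rk (A ∪ B)) (rk (A ∪ D)) (begin
    rk (A ∪ B) + rk D                    ≤⟨ +-mono-≤ (monotone _ _ A∪B⊆) (monotone _ _ D⊆) ⟩
    rk ((A ∪ D) ∪ B) + rk ((A ∪ D) ∩ B)  ≤⟨ submodular (A ∪ D) B ⟩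
    rk (A ∪ D) + rk B                    ≡⟨ cong (rk (A ∪ D) +_) rkB≡rkD ⟩
    rk (A ∪ D) + rk D                    ∎)
    where
    open ≤-Reasoning
    A∪B⊆ : A ∪ B ⊆ (A ∪ D) ∪ B
    A∪B⊆ = ∪-lub (p⊆p∪q B ∘ p⊆p∪q D) (q⊆p∪q _ B)
    D⊆ : D ⊆ (A ∪ D) ∩ B
    D⊆ x∈D = x∈p∩q⁺ (q⊆p∪q A D x∈D , D⊆B x∈D)

  ∈-preimage⁺ : ∀ {A x} → π x ∈ A → x ∈ preimage A
  ∈-preimage⁺ π[x]∈A = ∈-tabulate⁺ ([]=⇒lookup π[x]∈A)

  ∈-preimage⁻ : ∀ A {x} → x ∈ preimage A → π x ∈ A
  ∈-preimage⁻ A x∈ = lookup⇒[]= _ A (∈-tabulate⁻ x∈)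

  preimage-⊆ : ∀ {A B} → A ⊆ B → preimage A ⊆ preimage B
  preimage-⊆ {A} A⊆B x∈ = ∈-preimage⁺ (A⊆B (∈-preimage⁻ A x∈))

  π-surjective : ∀ i → ∃ λ x → π x ≡ i
  π-surjective i with 0<∣p∣⇒Nonempty (<-≤-trans (loopless i) (r≤∣fibre∣ r i))
  ... | x , x∈ = x , x∈⁅y⁆⇒x≡y i (∈-preimage⁻ ⁅ i ⁆ x∈)

  preimage-⊆⁻ : ∀ {A B} → preimage A ⊆ preimage B → A ⊆ B
  preimage-⊆⁻ {B = B} Ã⊆B̃ {i} i∈A with π-surjective i
  ... | x , refl = ∈-preimage⁻ B (Ã⊆B̃ (∈-preimage⁺ i∈A))

  preimage-∪ : ∀ A B → preimage (A ∪ B) ≡ preimage A ∪ preimage B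
  preimage-∪ A B = ⊆-antisym
    (λ x∈ → x∈p∪q⁺ (Sum.map ∈-preimage⁺ ∈-preimage⁺ (x∈p∪q⁻ A B (∈-preimage⁻ (A ∪ B) x∈))))
    (λ x∈ → ∈-preimage⁺ (x∈p∪q⁺ (Sum.map (∈-preimage⁻ A) (∈-preimage⁻ B) (x∈p∪q⁻ (preimage A) (preimage B) x∈))))

  preimage-─ : ∀ A B → preimage (A ─ B) ≡ preimage A ─ preimage B
  preimage-─ A B = ⊆-antisym
    (λ x∈ → let π[x]∈ = ∈-preimage⁻ (A ─ B) x∈ in
      x∈p∧x∉q⇒x∈p─q (∈-preimage⁺ (p─q⊆p A B π[x]∈)) (x∈p─q⇒x∉q A B π[x]∈ ∘ ∈-preimage⁻ B))
    (λ x∈ → ∈-preimage⁺ (x∈p∧x∉q⇒x∈p─q (∈-preimage⁻ A (p─q⊆p (preimage A) (preimage B) x∈))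
      (x∈p─q⇒x∉q (preimage A) (preimage B) x∈ ∘ ∈-preimage⁺)))

  preimage-⊥ : preimage ⊥ ≡ ⊥
  preimage-⊥ = ⊆-antisym (λ x∈ → contradiction (∈-preimage⁻ ⊥ x∈) ∉⊥) ⊥⊆

  preimage-⋃ : ∀ Fs → ⋃ (map preimage Fs) ≡ preimage (⋃ Fs)
  preimage-⋃ []       = sym preimage-⊥
  preimage-⋃ (F ∷ Fs) = trans (cong (preimage F ∪_) (preimage-⋃ Fs)) (sym (preimage-∪ F (⋃ Fs)))

  rk~-default : ∀ S → rk ⊥ + ∣ S ─ preimage ⊥ ∣ ≡ rk ⊥ + ∣ S ∣
  rk~-default S = cong (λ T → rk ⊥ + ∣ T ∣) (trans (cong (S ─_) preimage-⊥) (p─⊥≡p S))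

  rk~≤ : ∀ S A → rk~ S ≤ rk A + ∣ S ─ preimage A ∣
  rk~≤ S A = foldr-preservesᵒ {P = _≤ rk A + ∣ S ─ preimage A ∣}
    (λ x y → [ ≤-trans (m⊓n≤m x y) , ≤-trans (m⊓n≤n x y) ]) _ _
    (inj₂ (Any.map (≤-reflexive ∘ sym) (∈-map⁺ _ (∈-allSubsets A))))

  ≤rk~ : ∀ {k} S → (∀ A → k ≤ rk A + ∣ S ─ preimage A ∣) → k ≤ rk~ S
  ≤rk~ {k} S k≤ = foldr-preservesᵇ {P = k ≤_} ⊓-glb
    (subst (k ≤_) (rk~-default S) (k≤ ⊥)) (All.map⁺ (All.universal k≤ (allSubsets n)))

  rk~-attained : ∀ S → ∃ λ A → rk A + ∣ S ─ preimage A ∣ ≡ rk~ S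
  rk~-attained S with foldr-selective ⊓-sel (rk ⊥ + ∣ S ∣) (map (λ A → rk A + ∣ S ─ preimage A ∣) (allSubsets n))
  ... | inj₁ rk~S≡default = ⊥ , trans (rk~-default S) (sym rk~S≡default)
  ... | inj₂ rk~S∈ with ∈-map⁻ _ rk~S∈
  ...   | A , _ , rk~S≡ = A , sym rk~S≡

  rk~-mono : ∀ {S S′} → S ⊆ S′ → rk~ S ≤ rk~ S′
  rk~-mono {S} {S′} S⊆S′ = ≤rk~ S′ λ A →
    ≤-trans (rk~≤ S A) (+-monoʳ-≤ (rk A) (p⊆q⇒∣p∣≤∣q∣ (p⊆q⇒p─r⊆q─r (preimage A) S⊆S′)))

  -- By subadditivity each i ∈ X contributes at most rk {i} ≤ |π⁻¹(i)|.
  rk≤∣preimage∣ : ∀ X → rk X ≤ ∣ preimage X ∣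
  rk≤∣preimage∣ X = bounded ∣ X ∣ X ≤-refl
    where
    open ≤-Reasoning
    bounded : ∀ k X → ∣ X ∣ ≤ k → rk X ≤ ∣ preimage X ∣
    bounded k X ∣X∣≤k with nonempty? X
    ... | no X≡∅ = ≤-trans (≤-reflexive (trans (cong rk (Empty-unique X≡∅)) rk-empty)) z≤n
    bounded zero X ∣X∣≤0 | yes (i , i∈X) = contradiction ∣X∣≤0 (<⇒≱ (≤-<-trans z≤n (x∈p⇒∣p-x∣<∣p∣ i∈X)))
    bounded (suc k) X ∣X∣≤1+k | yes (i , i∈X) = begin
      rk X                                  ≤⟨ monotone _ _ (p⊆[p─q]∪q X ⁅ i ⁆) ⟩
      rk ((X - i) ∪ ⁅ i ⁆)                  ≤⟨ rk-∪-≤ (X - i) ⁅ i ⁆ ⟩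
      rk (X - i) + r i                      ≤⟨ +-mono-≤ (bounded k (X - i) ∣X-i∣≤k) (r≤∣fibre∣ r i) ⟩
      ∣ preimage (X - i) ∣ + ∣ preimage ⁅ i ⁆ ∣
        ≤⟨ +-mono-≤ (≤-reflexive (cong ∣_∣ (preimage-─ X ⁅ i ⁆))) (p⊆q⇒∣p∣≤∣q∣ fibre⊆) ⟩
      ∣ preimage X ─ preimage ⁅ i ⁆ ∣ + ∣ preimage X ∩ preimage ⁅ i ⁆ ∣
        ≡⟨ +-comm ∣ preimage X ─ preimage ⁅ i ⁆ ∣ _ ⟩
      ∣ preimage X ∩ preimage ⁅ i ⁆ ∣ + ∣ preimage X ─ preimage ⁅ i ⁆ ∣
        ≡⟨ sym (∣p∣≡∣p∩q∣+∣p─q∣ (preimage X) (preimage ⁅ i ⁆)) ⟩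
      ∣ preimage X ∣                        ∎
      where
      ∣X-i∣≤k : ∣ X - i ∣ ≤ k
      ∣X-i∣≤k = ≤-pred (<-≤-trans (x∈p⇒∣p-x∣<∣p∣ i∈X) ∣X∣≤1+k)
      fibre⊆ : preimage ⁅ i ⁆ ⊆ preimage X ∩ preimage ⁅ i ⁆
      fibre⊆ x∈ = x∈p∩q⁺ (preimage-⊆ (x∈p⇒⁅x⁆⊆p i∈X) x∈ , x∈)

  rk-∪-≤-∣preimage-─∣ : ∀ A X → rk (A ∪ X) ≤ rk A + ∣ preimage X ─ preimage A ∣
  rk-∪-≤-∣preimage-─∣ A X = begin
    rk (A ∪ X)                          ≤⟨ monotone _ _ (∪-lub (q⊆p∪q _ A) (p⊆[p─q]∪q X A)) ⟩
    rk ((X ─ A) ∪ A)                    ≤⟨ rk-∪-≤ (X ─ A) A ⟩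
    rk (X ─ A) + rk A                   ≡⟨ +-comm (rk (X ─ A)) (rk A) ⟩
    rk A + rk (X ─ A)                   ≤⟨ +-monoʳ-≤ (rk A) (rk≤∣preimage∣ (X ─ A)) ⟩
    rk A + ∣ preimage (X ─ A) ∣         ≡⟨ cong (λ T → rk A + ∣ T ∣) (preimage-─ X A) ⟩
    rk A + ∣ preimage X ─ preimage A ∣  ∎
    where open ≤-Reasoning

  rk~-preimage : ∀ X → rk~ (preimage X) ≡ rk X
  rk~-preimage X = ≤-antisym
    (≤-trans (rk~≤ (preimage X) X) (≤-reflexive (trans (cong (rk X +_) (∣p─p∣≡0 (preimage X))) (+-identityʳ _))))
    (≤rk~ (preimage X) λ A → ≤-trans (monotone _ _ (q⊆p∪q A X)) (rk-∪-≤-∣preimage-─∣ A X))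

  preimage-flat : ∀ {F} → IsFlat rk F → IsFlat rk~ (preimage F)
  preimage-flat {F} flatF B F̃⊆B rk~B≡ {x} x∈B with π x ∈? F
  ... | yes π[x]∈F = ∈-preimage⁺ π[x]∈F
  ... | no  π[x]∉F = contradiction (begin-strict
    rk F               <⟨ ≤rk~ B bound ⟩
    rk~ B              ≡⟨ rk~B≡ ⟩
    rk~ (preimage F)   ≡⟨ rk~-preimage F ⟩
    rk F               ∎) (n≮n (rk F))
    where
    open ≤-Reasoning
    F̃─Ã⊆B─Ã : ∀ A → preimage F ─ preimage A ⊆ B ─ preimage A
    F̃─Ã⊆B─Ã A = p⊆q⇒p─r⊆q─r (preimage A) F̃⊆B
    bound : ∀ A → rk F < rk A + ∣ B ─ preimage A ∣
    bound A with π x ∈? A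
    ... | no π[x]∉A = begin-strict
      rk F                                ≤⟨ monotone _ _ (q⊆p∪q A F) ⟩
      rk (A ∪ F)                          ≤⟨ rk-∪-≤-∣preimage-─∣ A F ⟩
      rk A + ∣ preimage F ─ preimage A ∣  <⟨ +-monoʳ-< (rk A) (p⊂q⇒∣p∣<∣q∣ F̃─Ã⊂B─Ã) ⟩
      rk A + ∣ B ─ preimage A ∣           ∎
      where
      F̃─Ã⊂B─Ã : preimage F ─ preimage A ⊂ B ─ preimage A
      F̃─Ã⊂B─Ã = F̃─Ã⊆B─Ã A , x , x∈p∧x∉q⇒x∈p─q x∈B (π[x]∉A ∘ ∈-preimage⁻ A)
              , π[x]∉F ∘ ∈-preimage⁻ F ∘ p─q⊆p (preimage F) (preimage A)
    ... | yes π[x]∈A = begin-strict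
      rk F                                <⟨ ≤∧≢⇒< (monotone _ _ (q⊆p∪q A F)) rk[F]≢rk[A∪F] ⟩
      rk (A ∪ F)                          ≤⟨ rk-∪-≤-∣preimage-─∣ A F ⟩
      rk A + ∣ preimage F ─ preimage A ∣  ≤⟨ +-monoʳ-≤ (rk A) (p⊆q⇒∣p∣≤∣q∣ (F̃─Ã⊆B─Ã A)) ⟩
      rk A + ∣ B ─ preimage A ∣           ∎
      where
      rk[F]≢rk[A∪F] : rk F ≢ rk (A ∪ F)
      rk[F]≢rk[A∪F] rk≡ = π[x]∉F (flatF (A ∪ F) (q⊆p∪q A F) (sym rk≡) (x∈p∪q⁺ (inj₁ π[x]∈A)))

  fullFibres : Subset m → Subset n
  fullFibres H = tabulate (λ i → does (preimage ⁅ i ⁆ ⊆? H))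

  preimage-⊆⇒⊆-fullFibres : ∀ {A H} → preimage A ⊆ H → A ⊆ fullFibres H
  preimage-⊆⇒⊆-fullFibres {H = H} Ã⊆H {i} i∈A =
    ∈-tabulate⁺ (dec-true (preimage ⁅ i ⁆ ⊆? H) (Ã⊆H ∘ preimage-⊆ (x∈p⇒⁅x⁆⊆p i∈A)))

  preimage-fullFibres-⊆ : ∀ H → preimage (fullFibres H) ⊆ H
  preimage-fullFibres-⊆ H {x} x∈ with preimage ⁅ π x ⁆ ⊆? H | ∈-tabulate⁻ (∈-preimage⁻ (fullFibres H) x∈)
  ... | yes fibre⊆H | _ = fibre⊆H (∈-preimage⁺ (x∈⁅x⁆ (π x)))
  ... | no  _       | ()

  -- Test rk~ (H ∪ {y}) against A ∪ B, where A attains rk~ H: submodularity gives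
  -- rk (A ∪ B) ≤ rk (A ∪ fullFibres H), and y ∈ π⁻¹(B) costs nothing.
  rk~-∪⁅⁆-≤ : ∀ H B y → fullFibres H ⊆ B → rk B ≡ rk (fullFibres H) → π y ∈ B →
              rk~ (H ∪ ⁅ y ⁆) ≤ rk~ H
  rk~-∪⁅⁆-≤ H B y D⊆B rkB≡rkD π[y]∈B with rk~-attained H
  ... | A , attained = begin
    rk~ (H ∪ ⁅ y ⁆)                                    ≤⟨ rk~≤ (H ∪ ⁅ y ⁆) (A ∪ B) ⟩
    rk (A ∪ B) + ∣ (H ∪ ⁅ y ⁆) ─ preimage (A ∪ B) ∣    ≤⟨ +-mono-≤ (rk-∪-absorb A D⊆B rkB≡rkD) (p⊆q⇒∣p∣≤∣q∣ y-absorbed) ⟩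
    rk (A ∪ D) + ∣ H ─ preimage (A ∪ B) ∣              ≤⟨ +-monoˡ-≤ _ (rk-∪-≤-∣preimage-─∣ A D) ⟩
    rk A + ∣ preimage D ─ preimage A ∣ + ∣ H ─ preimage (A ∪ B) ∣
      ≤⟨ +-mono-≤ (+-monoʳ-≤ (rk A) (p⊆q⇒∣p∣≤∣q∣ D̃─Ã⊆)) (≤-reflexive (cong ∣_∣ H─Ã∪B̃)) ⟩
    rk A + ∣ (H ─ preimage A) ∩ preimage B ∣ + ∣ (H ─ preimage A) ─ preimage B ∣
      ≡⟨ +-assoc (rk A) _ _ ⟩
    rk A + (∣ (H ─ preimage A) ∩ preimage B ∣ + ∣ (H ─ preimage A) ─ preimage B ∣)
      ≡⟨ cong (rk A +_) (sym (∣p∣≡∣p∩q∣+∣p─q∣ (H ─ preimage A) (preimage B))) ⟩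
    rk A + ∣ H ─ preimage A ∣                          ≡⟨ attained ⟩
    rk~ H                                              ∎
    where
    open ≤-Reasoning
    D = fullFibres H
    y-absorbed : (H ∪ ⁅ y ⁆) ─ preimage (A ∪ B) ⊆ H ─ preimage (A ∪ B)
    y-absorbed {z} z∈ with x∈p∪q⁻ H ⁅ y ⁆ (p─q⊆p (H ∪ ⁅ y ⁆) (preimage (A ∪ B)) z∈)
    ... | inj₁ z∈H = x∈p∧x∉q⇒x∈p─q z∈H (x∈p─q⇒x∉q (H ∪ ⁅ y ⁆) _ z∈)
    ... | inj₂ z∈⁅y⁆ rewrite x∈⁅y⁆⇒x≡y y z∈⁅y⁆ =
      contradiction (∈-preimage⁺ (x∈p∪q⁺ {p = A} (inj₂ π[y]∈B))) (x∈p─q⇒x∉q (H ∪ ⁅ y ⁆) _ z∈)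
    H─Ã∪B̃ : H ─ preimage (A ∪ B) ≡ (H ─ preimage A) ─ preimage B
    H─Ã∪B̃ = trans (cong (H ─_) (preimage-∪ A B)) (sym (p─q─r≡p─q∪r H _ _))
    D̃─Ã⊆ : preimage D ─ preimage A ⊆ (H ─ preimage A) ∩ preimage B
    D̃─Ã⊆ z∈ = let z∈D̃ = p─q⊆p (preimage D) (preimage A) z∈ in
      x∈p∩q⁺ ( x∈p∧x∉q⇒x∈p─q (preimage-fullFibres-⊆ H z∈D̃) (x∈p─q⇒x∉q (preimage D) _ z∈)
             , preimage-⊆ D⊆B z∈D̃)

  fullFibres-flat : ∀ {H} → IsFlat rk~ H → IsFlat rk (fullFibres H)
  fullFibres-flat {H} flatH B D⊆B rkB≡rkD {i} i∈B =
    preimage-⊆⇒⊆-fullFibres {A = ⁅ i ⁆} fibre⊆H (x∈⁅x⁆ i)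
    where
    fibre⊆H : preimage ⁅ i ⁆ ⊆ H
    fibre⊆H {y} y∈ = flatH (H ∪ ⁅ y ⁆) (p⊆p∪q ⁅ y ⁆)
      (≤-antisym (rk~-∪⁅⁆-≤ H B y D⊆B rkB≡rkD π[y]∈B) (rk~-mono {H} (p⊆p∪q ⁅ y ⁆)))
      (x∈p∪q⁺ (inj₂ (x∈⁅x⁆ y)))
      where
      π[y]∈B : π y ∈ B
      π[y]∈B = subst (_∈ B) (sym (x∈⁅y⁆⇒x≡y i (∈-preimage⁻ ⁅ i ⁆ y∈))) i∈B

  preimage-closure : ∀ {A C} → IsClosure rk A C → IsClosure rk~ (preimage A) (preimage C)
  preimage-closure (flatC , A⊆C , least) =
    preimage-flat flatC , preimage-⊆ A⊆C , λ H flatH Ã⊆H →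
      ⊆-trans (preimage-⊆ (least _ (fullFibres-flat flatH) (preimage-⊆⇒⊆-fullFibres Ã⊆H)))
              (preimage-fullFibres-⊆ H)

  preimage-closure⁻ : ∀ {A C} → IsFlat rk C → IsClosure rk~ (preimage A) (preimage C) → IsClosure rk A C
  preimage-closure⁻ flatC (_ , Ã⊆C̃ , least) =
    flatC , preimage-⊆⁻ Ã⊆C̃ , λ H flatH A⊆H → preimage-⊆⁻ (least _ (preimage-flat flatH) (preimage-⊆ A⊆H))

  preimage-incomparable : ∀ {A B} → Incomparable A B → Incomparable (preimage A) (preimage B)
  preimage-incomparable (A⊈B , B⊈A) = A⊈B ∘ preimage-⊆⁻ , B⊈A ∘ preimage-⊆⁻

  preimage-incomparable⁻ : ∀ {A B} → Incomparable (preimage A) (preimage B) → Incomparable A B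
  preimage-incomparable⁻ (Ã⊈B̃ , B̃⊈Ã) = Ã⊈B̃ ∘ preimage-⊆ , B̃⊈Ã ∘ preimage-⊆

  nested-lift⁻ : ∀ {𝒢 𝒩} → IsNested rk~ (G~ 𝒢) (N~ 𝒩) → IsNested rk 𝒢 𝒩
  nested-lift⁻ nested Fs 𝒩Fs incFs 2≤∣Fs∣ C closure 𝒢C =
    nested (map preimage Fs)
      (All.map⁺ (All.map (λ {F} 𝒩F → F , 𝒩F , refl) 𝒩Fs))
      (AllPairs.map⁺ (AllPairs.map preimage-incomparable incFs))
      (subst (2 ≤_) (sym (length-map preimage Fs)) 2≤∣Fs∣)
      (preimage C)
      (subst (λ U → IsClosure rk~ U (preimage C)) (sym (preimage-⋃ Fs)) (preimage-closure closure))
      (inj₁ (C , 𝒢C , refl))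

  nested-lift⁺ : ∀ {𝒢 𝒩} → (∀ G → 𝒢 G → IsFlat rk G) → (∀ F → 𝒩 F → IsFlat rk F) →
                 IsNested rk 𝒢 𝒩 → IsNested rk~ (G~ 𝒢) (N~ 𝒩)
  nested-lift⁺ _ flat𝒩 _ Xs 𝒩̃Xs incXs 2≤∣Xs∣ _ (_ , ⋃Xs⊆C , _) (inj₂ atomC) =
    atom-⊉-incomparable Xs (All.map (λ { (F , 𝒩F , refl) → preimage-flat (flat𝒩 F 𝒩F) }) 𝒩̃Xs)
      incXs 2≤∣Xs∣ ⋃Xs⊆C atomC
  nested-lift⁺ flat𝒢 _ nested Xs 𝒩̃Xs incXs 2≤∣Xs∣ _ closure (inj₁ (G , 𝒢G , refl))
    with all-image preimage 𝒩̃Xs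
  ... | Fs , refl , 𝒩Fs =
    nested Fs 𝒩Fs
      (AllPairs.map preimage-incomparable⁻ (AllPairs.map⁻ incXs))
      (subst (2 ≤_) (length-map preimage Fs) 2≤∣Xs∣)
      G
      (preimage-closure⁻ (flat𝒢 G 𝒢G) (subst (λ U → IsClosure rk~ U (preimage G)) (preimage-⋃ Fs) closure))
      𝒢G

lemma3p4 : ∀ {n : ℕ} (rk : Subset n → ℕ) → IsPolymatroid rk →
    (𝒢 : Pred (Subset n) 0ℓ) → IsGeometricBuildingSet rk 𝒢 → 𝒢 ⊤ →
    (𝒩 : Pred (Subset n) 0ℓ) → (∀ F → 𝒩 F → 𝒢 F) →
    (IsNested rk 𝒢 𝒩 → IsNested (Lift.rk~ rk) (Lift.G~ rk 𝒢) (Lift.N~ rk 𝒩))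
    × (IsNested (Lift.rk~ rk) (Lift.G~ rk 𝒢) (Lift.N~ rk 𝒩) → IsNested rk 𝒢 𝒩)
lemma3p4 rk isP 𝒢 building _ 𝒩 𝒩⊆𝒢 =
  nested-lift⁺ flat𝒢 (λ F → flat𝒢 F ∘ 𝒩⊆𝒢 F) , nested-lift⁻
  where
  open Polymatroid isP
  flat𝒢 : ∀ G → 𝒢 G → IsFlat rk G
  flat𝒢 G = proj₁ ∘ IsGeometricBuildingSet.nonempty-flats building G
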